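{- Let $\mathbb{K}=(G,M,I)$ be a finite formal context with concept lattice $\underline{\mathfrak{B}}(\mathbb{K})$ having least element $\bot$ and greatest element $\top$, and let $\underline{S}=\{c\}$ be an interval of $\underline{\mathfrak{B}}(\mathbb{K})$ with exactly one element. Then $\underline{S}$ is quasi-dismantling for $\underline{\mathfrak{B}}(\mathbb{K})$ if and only if one of the following holds: (a) $c$ is doubly irreducible; (b) $c=\top$ and $c$ is supremum-irreducible; (c) $c=\bot$ and $c$ is infimum-irreducible; (d) $c=\top=\bot$.
   Context: The concept lattice $\underline{\mathfrak{B}}(\mathbb{K})$ is the set of formal concepts $(A,B)$ ($A'=B$, $B'=A$) ordered by extent inclusion. For $u\le v$, $[u,v]=\{x\mid u\le x\le v\}$, $(v]=\{x\mid x\le v\}$, $[u)=\{x\mid u\le x\}$. An interval $[u,v]$ is quasi-dismantling for a lattice $L$ if $u$ is supremum-prime in $(v]$ (for all $x,y\in (v]$: $u\le x\vee y$ implies $u\le x$ or $u\le y$) and $v$ is infimum-prime in $[u)$ (for all $x,y\in[u)$: $x\wedge y\le v$ implies $x\le v$ or $y\le v$). For $c\in L$ let $c_*=\bigvee\{x\mid x<c\}$ and $c^*=\bigwedge\{x\mid x>c\}$; $c$ is supremum-irreducible if $c_*<c$, infimum-irreducible if $c^*>c$, and doubly irreducible if both hold. -}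

module Defs where

open import Data.Nat using (ℕ; zero; suc)
open import Data.Bool using (Bool; true; false; _∧_; _∨_; not)
open import Data.Fin using (Fin; zero; suc)
open import Data.Fin.Subset using (Subset; _⊆_)
open import Data.Vec using (tabulate; lookup)
open import Data.Product using (_×_)
open import Data.Sum using (_⊎_)
open import Relation.Nullary using (¬_)
open import Relation.Binary.PropositionalEquality using (_≡_)

allᵇ : ∀ {k} → (Fin k → Bool) → Bool
allᵇ {zero}  f = true
allᵇ {suc k} f = f zero ∧ allᵇ (λ i → f (suc i))

-- A finite formal context K = (G, M, I) with G = Fin n, M = Fin m and
-- incidence relation I given by its (Boolean) characteristic function.
Context : ℕ → ℕ → Set
Context n m = Fin n → Fin m → Bool

module _ {n m : ℕ} (I : Context n m) where

  up : Subset n → Subset m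
  up A = tabulate (λ j → allᵇ (λ i → not (lookup A i) ∨ I i j))

  down : Subset m → Subset n
  down B = tabulate (λ i → allᵇ (λ j → not (lookup B j) ∨ I i j))

  record Concept : Set where
    constructor concept
    field
      extent  : Subset n
      intent  : Subset m
      up-ext  : up extent ≡ intent
      down-int : down intent ≡ extent
  open Concept public

  _≤_ : Concept → Concept → Set
  x ≤ y = extent x ⊆ extent y

  _<_ : Concept → Concept → Set
  x < y = x ≤ y × ¬ (y ≤ x)

  IsJoin : Concept → Concept → Concept → Set
  IsJoin x y z = x ≤ z × y ≤ z × (∀ w → x ≤ w → y ≤ w → z ≤ w)

  IsMeet : Concept → Concept → Concept → Set
  IsMeet x y z = z ≤ x × z ≤ y × (∀ w → w ≤ x → w ≤ y → w ≤ z)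

  IsSup : (Concept → Set) → Concept → Set
  IsSup P s = (∀ x → P x → x ≤ s) × (∀ w → (∀ x → P x → x ≤ w) → s ≤ w)

  IsInf : (Concept → Set) → Concept → Set
  IsInf P s = (∀ x → P x → s ≤ x) × (∀ w → (∀ x → P x → w ≤ x) → w ≤ s)

  IsTop : Concept → Set
  IsTop c = ∀ x → x ≤ c

  IsBot : Concept → Set
  IsBot c = ∀ x → c ≤ x

  SupPrimeIn↓ : Concept → Concept → Set
  SupPrimeIn↓ u v = ∀ x y z → x ≤ v → y ≤ v → IsJoin x y z → u ≤ z → u ≤ x ⊎ u ≤ y

  InfPrimeIn↑ : Concept → Concept → Set
  InfPrimeIn↑ u v = ∀ x y z → u ≤ x → u ≤ y → IsMeet x y z → z ≤ v → x ≤ v ⊎ y ≤ v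

  QuasiDismantling : Concept → Concept → Set
  QuasiDismantling u v = SupPrimeIn↓ u v × InfPrimeIn↑ u v

  SupIrreducible : Concept → Set
  SupIrreducible c = ∀ s → IsSup (λ x → x < c) s → s < c

  InfIrreducible : Concept → Set
  InfIrreducible c = ∀ s → IsInf (λ x → c < x) s → c < s

  DoublyIrreducible : Concept → Set
  DoublyIrreducible c = SupIrreducible c × InfIrreducible c

{-# OPTIONS --safe #-}
-- For the one-element interval [c, c], quasi-dismantling means that c is supremum-prime
-- in (c] and, dually, infimum-prime in [c); it suffices to show that the first holds
-- iff c is supremum-irreducible or c = ⊥. A finite lattice is the join-closure of
-- finitely many generators (the object concepts), so c_* exists and is the finite join
-- of the generators strictly below c. If c ≠ ⊥ is supremum-prime in (c], it lies below
-- no finite join of elements strictly below it, hence c_* < c. Conversely, if c_* < c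
-- and x, y ≤ c with c ≰ x, y, then x ∨ y ≤ c_*, so c ≰ x ∨ y. The dual statement is the
-- same argument for the reversed order, generated by the attribute concepts.
module Submission where

open import Data.Nat as Nat using (ℕ)
open import Data.Bool using (Bool; true; false; _∧_; _∨_; not)
open import Data.Bool.Properties using (∧-conicalˡ; ∧-conicalʳ)
open import Data.Empty using (⊥-elim)
open import Data.Fin using (Fin; zero; suc)
open import Data.Fin.Subset using (Subset; _⊆_; _∈_; _∪_; ⁅_⁆; ⊥)
open import Data.Fin.Subset.Properties
  using (⊆-antisym; ⊆-trans; _⊆?_; p⊆p∪q; q⊆p∪q; x∈p∪q⁻; x∈⁅x⁆; x∈⁅y⁆⇒x≡y; ⊥⊆)
open import Data.List using (List; []; _∷_; foldr; filter; tabulate)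
open import Data.List.Membership.Propositional using () renaming (_∈_ to _∈ₗ_)
open import Data.List.Membership.Propositional.Properties using (∈-filter⁺; ∈-tabulate⁺)
open import Data.List.Relation.Unary.All as All using (All; []; _∷_)
open import Data.List.Relation.Unary.All.Properties using (all-filter)
open import Data.List.Relation.Unary.Any using (here; there)
open import Data.Product using (_×_; _,_; proj₁; proj₂)
open import Data.Product.Function.NonDependent.Propositional using (_×-⇔_)
open import Data.Sum using (_⊎_; inj₁; inj₂; [_,_])
open import Data.Vec using (lookup)
open import Data.Vec.Properties using (lookup∘tabulate; []=⇒lookup; lookup⇒[]=)
open import Function using (_∘_; flip)
open import Function.Bundles using (_⇔_; mk⇔)
import Function.Properties.Equivalence as ⇔
open import Relation.Binary.PropositionalEquality using (_≡_; refl; sym; trans; cong₂; subst; subst₂)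
open import Relation.Nullary using (¬_; Dec; yes; no; ¬?; _×-dec_)

module FiniteJoinDense {C : Set} (_≼_ : C → C → Set) where

  _≺_ : C → C → Set
  x ≺ y = x ≼ y × ¬ (y ≼ x)

  IsJoin : C → C → C → Set
  IsJoin x y z = x ≼ z × y ≼ z × (∀ w → x ≼ w → y ≼ w → z ≼ w)

  IsSup : (C → Set) → C → Set
  IsSup P s = (∀ x → P x → x ≼ s) × (∀ w → (∀ x → P x → x ≼ w) → s ≼ w)

  IsBottom : C → Set
  IsBottom c = ∀ x → c ≼ x

  SupPrimeIn↓ : C → C → Set
  SupPrimeIn↓ u v = ∀ x y z → x ≼ v → y ≼ v → IsJoin x y z → u ≼ z → u ≼ x ⊎ u ≼ y

  SupIrreducible : C → Set
  SupIrreducible c = ∀ s → IsSup (_≺ c) s → s ≺ c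

  module _ (≼-trans : ∀ {x y z} → x ≼ y → y ≼ z → x ≼ z) (_≼?_ : ∀ x y → Dec (x ≼ y))
           (_⊔_ : C → C → C) (⊔-isJoin : ∀ x y → IsJoin x y (x ⊔ y))
           (bottom : C) (bottom-isBottom : IsBottom bottom)
           (gens : List C) (gens-dense : ∀ x y → (∀ g → g ∈ₗ gens → g ≼ x → g ≼ y) → x ≼ y)
           where

    ⋁ : List C → C
    ⋁ = foldr _⊔_ bottom

    ⋁-upper : ∀ {g l} → g ∈ₗ l → g ≼ ⋁ l
    ⋁-upper (here refl) = proj₁ (⊔-isJoin _ _)
    ⋁-upper (there g∈l) = ≼-trans (⋁-upper g∈l) (proj₁ (proj₂ (⊔-isJoin _ _)))

    ⋁-least : ∀ {l w} → All (_≼ w) l → ⋁ l ≼ w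
    ⋁-least {w = w} []    = bottom-isBottom w
    ⋁-least (g≼w ∷ l≼w) = proj₂ (proj₂ (⊔-isJoin _ _)) _ g≼w (⋁-least l≼w)

    _≺?_ : ∀ x y → Dec (x ≺ y)
    x ≺? y = (x ≼? y) ×-dec ¬? (y ≼? x)

    lowerSup : C → C
    lowerSup c = ⋁ (filter (_≺? c) gens)

    lowerSup-isSup : ∀ c → IsSup (_≺ c) (lowerSup c)
    lowerSup-isSup c = upper , least
      where
      upper : ∀ x → x ≺ c → x ≼ lowerSup c
      upper x (x≼c , c⋠x) = gens-dense x (lowerSup c) λ g g∈gens g≼x →
        ⋁-upper (∈-filter⁺ (_≺? c) g∈gens (≼-trans g≼x x≼c , λ c≼g → c⋠x (≼-trans c≼g g≼x)))

      least : ∀ w → (∀ x → x ≺ c → x ≼ w) → lowerSup c ≼ w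
      least w below⇒≼w = ⋁-least (All.map (below⇒≼w _) (all-filter (_≺? c) gens))

    supPrime⇒⋠⋁ : ∀ {c} → SupPrimeIn↓ c c → ¬ c ≼ bottom → ∀ {l} → All (_≺ c) l → ¬ c ≼ ⋁ l
    supPrime⇒⋠⋁ prime c⋠⊥ [] = c⋠⊥
    supPrime⇒⋠⋁ prime c⋠⊥ {g ∷ l} ((g≼c , c⋠g) ∷ l≺c) c≼⋁
      with prime g (⋁ l) _ g≼c (⋁-least (All.map proj₁ l≺c)) (⊔-isJoin g (⋁ l)) c≼⋁
    ... | inj₁ c≼g = c⋠g c≼g
    ... | inj₂ c≼⋁l = supPrime⇒⋠⋁ prime c⋠⊥ l≺c c≼⋁l

    supPrime⇒supIrreducible⊎bottom : ∀ c → SupPrimeIn↓ c c → SupIrreducible c ⊎ IsBottom c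
    supPrime⇒supIrreducible⊎bottom c prime with c ≼? bottom
    ... | yes c≼⊥ = inj₂ λ x → ≼-trans c≼⊥ (bottom-isBottom x)
    ... | no c⋠⊥  = inj₁ λ s (_ , least) → least c (λ _ → proj₁) , λ c≼s →
      supPrime⇒⋠⋁ prime c⋠⊥ (all-filter (_≺? c) gens)
        (≼-trans c≼s (least (lowerSup c) (proj₁ (lowerSup-isSup c))))

    supIrreducible⇒supPrime : ∀ c → SupIrreducible c → SupPrimeIn↓ c c
    supIrreducible⇒supPrime c irr x y z x≼c y≼c (_ , _ , z-least) c≼z with c ≼? x | c ≼? y
    ... | yes c≼x | _       = inj₁ c≼x
    ... | no _    | yes c≼y = inj₂ c≼y
    ... | no c⋠x  | no c⋠y  = ⊥-elim (proj₂ (irr _ (lowerSup-isSup c))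
          (≼-trans c≼z (z-least _ (upper x (x≼c , c⋠x)) (upper y (y≼c , c⋠y)))))
      where
      upper : ∀ x → x ≺ c → x ≼ lowerSup c
      upper = proj₁ (lowerSup-isSup c)

    bottom⇒supPrime : ∀ c → IsBottom c → SupPrimeIn↓ c c
    bottom⇒supPrime c c-bottom x _ _ _ _ _ _ = inj₁ (c-bottom x)

    supPrime⇔supIrreducible⊎bottom : ∀ c → SupPrimeIn↓ c c ⇔ (SupIrreducible c ⊎ IsBottom c)
    supPrime⇔supIrreducible⊎bottom c = mk⇔ (supPrime⇒supIrreducible⊎bottom c)
      [ supIrreducible⇒supPrime c , bottom⇒supPrime c ]

open import Defs

allᵇ-true⁻ : ∀ {k} (f : Fin k → Bool) → allᵇ f ≡ true → ∀ i → f i ≡ true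
allᵇ-true⁻ f all-f zero    = ∧-conicalˡ _ _ all-f
allᵇ-true⁻ f all-f (suc i) = allᵇ-true⁻ (f ∘ suc) (∧-conicalʳ _ _ all-f) i

allᵇ-true⁺ : ∀ {k} (f : Fin k → Bool) → (∀ i → f i ≡ true) → allᵇ f ≡ true
allᵇ-true⁺ {Nat.zero}  f _      = refl
allᵇ-true⁺ {Nat.suc k} f f-true = cong₂ _∧_ (f-true zero) (allᵇ-true⁺ (f ∘ suc) (f-true ∘ suc))

not-∨-true⁻ : ∀ a b → not a ∨ b ≡ true → a ≡ true → b ≡ true
not-∨-true⁻ true b ¬a∨b refl = ¬a∨b

not-∨-true⁺ : ∀ a b → (a ≡ true → b ≡ true) → not a ∨ b ≡ true
not-∨-true⁺ false b _   = refl
not-∨-true⁺ true  b a⇒b = a⇒b refl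

-- down I = up (flip I) definitionally, so every lemma about up also serves for down.
module _ {n m : ℕ} (I : Context n m) where

  ∈-up⁻ : ∀ {A j i} → j ∈ up I A → i ∈ A → I i j ≡ true
  ∈-up⁻ {A} {j} {i} j∈A′ i∈A = not-∨-true⁻ (lookup A i) (I i j)
    (allᵇ-true⁻ _ (trans (sym (lookup∘tabulate _ j)) ([]=⇒lookup j∈A′)) i) ([]=⇒lookup i∈A)

  ∈-up⁺ : ∀ {A j} → (∀ {i} → i ∈ A → I i j ≡ true) → j ∈ up I A
  ∈-up⁺ {A} {j} incident = lookup⇒[]= j _ (trans (lookup∘tabulate _ j)
    (allᵇ-true⁺ _ λ i → not-∨-true⁺ (lookup A i) (I i j) (incident ∘ lookup⇒[]= i A)))

  up-antitone : ∀ {A B} → A ⊆ B → up I B ⊆ up I A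
  up-antitone A⊆B j∈B′ = ∈-up⁺ (∈-up⁻ j∈B′ ∘ A⊆B)

⊆-down-up : ∀ {n m} (I : Context n m) A → A ⊆ down I (up I A)
⊆-down-up I A i∈A = ∈-up⁺ (flip I) λ j∈A′ → ∈-up⁻ I j∈A′ i∈A

up-down-up : ∀ {n m} (I : Context n m) A → up I (down I (up I A)) ≡ up I A
up-down-up I A = ⊆-antisym (up-antitone I (⊆-down-up I A)) (⊆-down-up (flip I) (up I A))

∪-least : ∀ {k} {p q r : Subset k} → p ⊆ r → q ⊆ r → p ∪ q ⊆ r
∪-least {p = p} {q} p⊆r q⊆r x∈p∪q = [ p⊆r , q⊆r ] (x∈p∪q⁻ p q x∈p∪q)

⁅⁆⊆ : ∀ {k} {S : Subset k} {i} → i ∈ S → ⁅ i ⁆ ⊆ S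
⁅⁆⊆ {S = S} i∈S j∈⁅i⁆ = subst (_∈ S) (sym (x∈⁅y⁆⇒x≡y _ j∈⁅i⁆)) i∈S

module ConceptLattice {n m : ℕ} (I : Context n m) where

  objectClosure : Subset n → Concept I
  objectClosure A = concept (down I (up I A)) (up I A) (up-down-up I A) refl

  attributeClosure : Subset m → Concept I
  attributeClosure B = concept (down I B) (up I (down I B)) refl (up-down-up (flip I) B)

  ≤⇒intent-⊇ : ∀ x y → _≤_ I x y → intent y ⊆ intent x
  ≤⇒intent-⊇ x y x≤y = subst₂ _⊆_ (up-ext y) (up-ext x) (up-antitone I x≤y)

  intent-⊇⇒≤ : ∀ x y → intent y ⊆ intent x → _≤_ I x y
  intent-⊇⇒≤ x y y′⊆x′ = subst₂ _⊆_ (down-int x) (down-int y) (up-antitone (flip I) y′⊆x′)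

  objectClosure-least : ∀ {A} w → A ⊆ extent w → _≤_ I (objectClosure A) w
  objectClosure-least {A} w A⊆w = intent-⊇⇒≤ (objectClosure A) w (subst (_⊆ up I A) (up-ext w) (up-antitone I A⊆w))

  attributeClosure-greatest : ∀ {B} w → B ⊆ intent w → _≤_ I w (attributeClosure B)
  attributeClosure-greatest {B} w B⊆w = subst (_⊆ down I B) (down-int w) (up-antitone (flip I) B⊆w)

  join : Concept I → Concept I → Concept I
  join x y = objectClosure (extent x ∪ extent y)

  join-isJoin : ∀ x y → IsJoin I x y (join x y)
  join-isJoin x y = ⊆-trans (p⊆p∪q (extent y)) (⊆-down-up I _)
                  , ⊆-trans (q⊆p∪q (extent x) (extent y)) (⊆-down-up I _)
                  , λ w x≤w y≤w → objectClosure-least w (∪-least x≤w y≤w)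

  meet : Concept I → Concept I → Concept I
  meet x y = attributeClosure (intent x ∪ intent y)

  meet-isMeet : ∀ x y → IsMeet I x y (meet x y)
  meet-isMeet x y = intent-⊇⇒≤ (meet x y) x (⊆-trans (p⊆p∪q (intent y)) (⊆-down-up (flip I) _))
                  , intent-⊇⇒≤ (meet x y) y (⊆-trans (q⊆p∪q (intent x) (intent y)) (⊆-down-up (flip I) _))
                  , λ w w≤x w≤y → attributeClosure-greatest w (∪-least (≤⇒intent-⊇ w x w≤x) (≤⇒intent-⊇ w y w≤y))

  bot : Concept I
  bot = objectClosure ⊥

  bot-isBot : IsBot I bot
  bot-isBot x = objectClosure-least x ⊥⊆

  top : Concept I
  top = attributeClosure ⊥

  top-isTop : IsTop I top
  top-isTop x = attributeClosure-greatest x ⊥⊆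

  objectConcept : Fin n → Concept I
  objectConcept i = objectClosure ⁅ i ⁆

  attributeConcept : Fin m → Concept I
  attributeConcept j = attributeClosure ⁅ j ⁆

  objectConcepts-joinDense : ∀ x y → (∀ g → g ∈ₗ tabulate objectConcept → _≤_ I g x → _≤_ I g y) → _≤_ I x y
  objectConcepts-joinDense x y below-x⇒below-y {i} i∈x =
    below-x⇒below-y _ (∈-tabulate⁺ i) (objectClosure-least x (⁅⁆⊆ i∈x)) (⊆-down-up I _ (x∈⁅x⁆ i))

  attributeConcepts-meetDense : ∀ x y → (∀ g → g ∈ₗ tabulate attributeConcept → _≤_ I x g → _≤_ I y g) → _≤_ I y x
  attributeConcepts-meetDense x y above-x⇒above-y = intent-⊇⇒≤ y x λ {j} j∈x′ →
    ≤⇒intent-⊇ y (attributeConcept j) (above-x⇒above-y _ (∈-tabulate⁺ j) (attributeClosure-greatest x (⁅⁆⊆ j∈x′)))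
      (⊆-down-up (flip I) _ (x∈⁅x⁆ j))

  supPrime⇔supIrreducible⊎bot : ∀ c → SupPrimeIn↓ I c c ⇔ (SupIrreducible I c ⊎ IsBot I c)
  supPrime⇔supIrreducible⊎bot = FiniteJoinDense.supPrime⇔supIrreducible⊎bottom (_≤_ I)
    ⊆-trans (λ x y → extent x ⊆? extent y) join join-isJoin bot bot-isBot
    (tabulate objectConcept) objectConcepts-joinDense

  infPrime⇔infIrreducible⊎top : ∀ c → InfPrimeIn↑ I c c ⇔ (InfIrreducible I c ⊎ IsTop I c)
  infPrime⇔infIrreducible⊎top = FiniteJoinDense.supPrime⇔supIrreducible⊎bottom (flip (_≤_ I))
    (flip ⊆-trans) (λ x y → extent y ⊆? extent x) meet meet-isMeet top top-isTop
    (tabulate attributeConcept) attributeConcepts-meetDense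

×-distrib-⊎ : ∀ {A B P Q : Set} → ((A ⊎ B) × (P ⊎ Q)) ⇔ (A × P ⊎ Q × A ⊎ B × P ⊎ Q × B)
×-distrib-⊎ {A} {B} {P} {Q} = mk⇔ expand collect
  where
  expand : (A ⊎ B) × (P ⊎ Q) → A × P ⊎ Q × A ⊎ B × P ⊎ Q × B
  expand (inj₁ a , inj₁ p) = inj₁ (a , p)
  expand (inj₁ a , inj₂ q) = inj₂ (inj₁ (q , a))
  expand (inj₂ b , inj₁ p) = inj₂ (inj₂ (inj₁ (b , p)))
  expand (inj₂ b , inj₂ q) = inj₂ (inj₂ (inj₂ (q , b)))
  collect : A × P ⊎ Q × A ⊎ B × P ⊎ Q × B → (A ⊎ B) × (P ⊎ Q)
  collect (inj₁ (a , p))               = inj₁ a , inj₁ p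
  collect (inj₂ (inj₁ (q , a)))        = inj₁ a , inj₂ q
  collect (inj₂ (inj₂ (inj₁ (b , p)))) = inj₂ b , inj₁ p
  collect (inj₂ (inj₂ (inj₂ (q , b)))) = inj₂ b , inj₂ q

proposition3 : (n m : ℕ) (I : Context n m) (c : Concept I) →
    QuasiDismantling I c c ⇔
      (DoublyIrreducible I c
        ⊎ (IsTop I c × SupIrreducible I c)
        ⊎ (IsBot I c × InfIrreducible I c)
        ⊎ (IsTop I c × IsBot I c))
proposition3 n m I c =
  ⇔.trans (supPrime⇔supIrreducible⊎bot c ×-⇔ infPrime⇔infIrreducible⊎top c) ×-distrib-⊎
  where open ConceptLattice I
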